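{- For every type $A$, $A\le^a[[A]]$.
   Context: Simply typed $\lambda$-calculus over base type $0$; every type is uniquely $[A_1,\dots,A_n]:=A_1\to\cdots\to A_n\to0$; thus $[[A]]=(A\to0)\to0$. A context $\Gamma=x_1^{C_1},\dots,x_k^{C_k}$ is a finite list of distinct typed variables, $\{\Gamma\}$ its set, $[\Gamma]:=[C_1,\dots,C_k]$; terms identified up to $\beta\eta$ ($=_{\beta\eta}$); $\Lambda^\Xi(A)$ = terms of type $A$ with free variables in $\{\Xi\}$. A substitution $\varrho$ from $\Gamma$ to $\Delta$ assigns $\varrho_c\in\Lambda^\Delta(C)$ to each $c^C\in\{\Gamma\}$; for a fresh context $\Xi$, $\varrho^\Xi$ is $\varrho$ on $\{\Gamma\}$ and the identity on $\{\Xi\}$. $\varrho$ is an atomic reduction if for every fresh $\Xi$, all $a^A,b^B\in\{\Xi,\Gamma\}$ with $A\equiv[A_1,\dots,A_n]$, $B\equiv[B_1,\dots,B_m]$, and all $M_i\in\Lambda^{\Xi,\Delta}(A_i)$, $N_i\in\Lambda^{\Xi,\Delta}(B_i)$: $\varrho^\Xi_aM_1\cdots M_n=_{\beta\eta}\varrho^\Xi_bN_1\cdots N_m$ implies $a=b$ and all $M_i=N_i$. For types, $[\Gamma]\le^a[\Delta]$ means there is an atomic reduction from the context $\Gamma$ to the context $\Delta$. -}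

module Defs where

open import Data.List using (List; []; _∷_; _++_)
open import Data.Product using (Σ)

-- Simple types over the base type 0 (written `o`).

infixr 7 _⇒_
data Ty : Set where
  o   : Ty
  _⇒_ : Ty → Ty → Ty

⟦_⟧ : List Ty → Ty
⟦ [] ⟧     = o
⟦ A ∷ As ⟧ = A ⇒ ⟦ As ⟧

-- the unique list with A ≡ [args A]
args : Ty → List Ty
args o       = []
args (A ⇒ B) = A ∷ args B

-- [[A]] = (A → 0) → 0
⟦⟦_⟧⟧ : Ty → Ty
⟦⟦ A ⟧⟧ = ⟦ ⟦ A ∷ [] ⟧ ∷ [] ⟧

-- Contexts (de Bruijn: distinctness of variables is automatic) and
-- intrinsically typed terms.

Ctx : Set
Ctx = List Ty

infix 4 _∋_
data _∋_ : Ctx → Ty → Set where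
  here  : ∀ {Γ A}   → A ∷ Γ ∋ A
  there : ∀ {Γ A B} → Γ ∋ A → B ∷ Γ ∋ A

data Tm (Γ : Ctx) : Ty → Set where
  var : ∀ {A}   → Γ ∋ A → Tm Γ A
  lam : ∀ {A B} → Tm (A ∷ Γ) B → Tm Γ (A ⇒ B)
  app : ∀ {A B} → Tm Γ (A ⇒ B) → Tm Γ A → Tm Γ B

Ren : Ctx → Ctx → Set
Ren Γ Δ = ∀ {C} → Γ ∋ C → Δ ∋ C

extR : ∀ {Γ Δ A} → Ren Γ Δ → Ren (A ∷ Γ) (A ∷ Δ)
extR ρ here      = here
extR ρ (there x) = there (ρ x)

rename : ∀ {Γ Δ A} → Ren Γ Δ → Tm Γ A → Tm Δ A
rename ρ (var x)   = var (ρ x)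
rename ρ (lam t)   = lam (rename (extR ρ) t)
rename ρ (app t u) = app (rename ρ t) (rename ρ u)

Sub : Ctx → Ctx → Set
Sub Γ Δ = ∀ {C} → Γ ∋ C → Tm Δ C

exts : ∀ {Γ Δ A} → Sub Γ Δ → Sub (A ∷ Γ) (A ∷ Δ)
exts σ here      = var here
exts σ (there x) = rename there (σ x)

subst : ∀ {Γ Δ A} → Sub Γ Δ → Tm Γ A → Tm Δ A
subst σ (var x)   = σ x
subst σ (lam t)   = lam (subst (exts σ) t)
subst σ (app t u) = app (subst σ t) (subst σ u)

single : ∀ {Γ A} → Tm Γ A → Sub (A ∷ Γ) Γ
single u here      = u
single u (there x) = var x

_[_] : ∀ {Γ A B} → Tm (A ∷ Γ) B → Tm Γ A → Tm Γ B
t [ u ] = subst (single u) t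

infix 3 _=βη_
data _=βη_ {Γ : Ctx} : ∀ {A} → Tm Γ A → Tm Γ A → Set where
  β      : ∀ {A B} (t : Tm (A ∷ Γ) B) (u : Tm Γ A) → app (lam t) u =βη t [ u ]
  η      : ∀ {A B} (t : Tm Γ (A ⇒ B)) → t =βη lam (app (rename there t) (var here))
  refl   : ∀ {A} {t : Tm Γ A} → t =βη t
  sym    : ∀ {A} {t u : Tm Γ A} → t =βη u → u =βη t
  trans  : ∀ {A} {t u v : Tm Γ A} → t =βη u → u =βη v → t =βη v
  cong-lam : ∀ {A B} {t t′ : Tm (A ∷ Γ) B} → t =βη t′ → lam t =βη lam t′
  cong-app : ∀ {A B} {t t′ : Tm Γ (A ⇒ B)} {u u′ : Tm Γ A} →
             t =βη t′ → u =βη u′ → app t u =βη app t′ u′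

data Args (Δ : Ctx) : List Ty → Set where
  []  : Args Δ []
  _∷_ : ∀ {A As} → Tm Δ A → Args Δ As → Args Δ (A ∷ As)

apps : ∀ {Δ A} → Tm Δ A → Args Δ (args A) → Tm Δ o
apps {A = o}     t []      = t
apps {A = A ⇒ B} t (m ∷ M) = apps (app t m) M

data ArgsEq {Δ : Ctx} : ∀ {As} → Args Δ As → Args Δ As → Set where
  []  : ArgsEq [] []
  _∷_ : ∀ {A As} {m n : Tm Δ A} {M N : Args Δ As} →
        m =βη n → ArgsEq M N → ArgsEq (m ∷ M) (n ∷ N)

-- "a = b and all Mᵢ = Nᵢ" (a, b possibly of different types a priori)
data SameHead {Θ Δ : Ctx} : ∀ {A B} → Θ ∋ A → Θ ∋ B →
                 Args Δ (args A) → Args Δ (args B) → Set where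
  same : ∀ {A} {a : Θ ∋ A} {M N : Args Δ (args A)} →
         ArgsEq M N → SameHead a a M N

lift : ∀ {Γ Δ} (Ξ : Ctx) → Sub Γ Δ → Sub (Ξ ++ Γ) (Ξ ++ Δ)
lift []      ϱ = ϱ
lift (C ∷ Ξ) ϱ = exts (lift Ξ ϱ)

IsAtomic : ∀ {Γ Δ} → Sub Γ Δ → Set
IsAtomic {Γ} {Δ} ϱ =
  ∀ (Ξ : Ctx) {A B} (a : Ξ ++ Γ ∋ A) (b : Ξ ++ Γ ∋ B)
    (M : Args (Ξ ++ Δ) (args A)) (N : Args (Ξ ++ Δ) (args B)) →
    apps (lift Ξ ϱ a) M =βη apps (lift Ξ ϱ b) N →
    SameHead a b M N

-- [Γ] ≤ᵃ [Δ]: an atomic reduction from the context Γ to the context Δ.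
-- For types A, B the contexts are (up to variable names) args A, args B.
infix 4 _≤ᵃ_
_≤ᵃ_ : Ty → Ty → Set
A ≤ᵃ B = Σ (Sub (args A) (args B)) IsAtomic

module Submission where

-- The reduction ϱ sends the argument x : C of A to λ y⃗. k (λ z⃗. z_x y⃗), where k : A → 0
-- is the variable of [[A]].  Hence ϱ^Ξ_a M⃗ has βη-normal form a M⃗' when a lies in Ξ, and
-- k (λ z⃗. z_x M⃗') when a is the argument x, where M⃗' are the normal forms of M⃗ (weakened
-- past z⃗).  The head and the arguments can be read back from such a normal form, and βη-equal
-- terms have equal normal forms: normalisation by evaluation in a Kripke model, together with
-- a logical relation showing that every term is βη-equal to its normal form.

open import Defs
open import Data.Empty using (⊥; ⊥-elim)
open import Data.List using (List; []; _∷_; _++_; length)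
open import Data.Nat using (ℕ; suc; _+_)
open import Data.Nat.Properties using (+-suc; +-identityʳ; suc-injective)
open import Data.Product using (_×_; _,_; proj₁; proj₂)
open import Data.Unit using (⊤; tt)
open import Relation.Binary.PropositionalEquality using (_≡_; cong; cong₂)
import Relation.Binary.PropositionalEquality as ≡
open ≡.≡-Reasoning

-- Renaming and substitution

idʳ : ∀ {Γ} → Ren Γ Γ
idʳ x = x

infixr 9 _∘ʳ_
_∘ʳ_ : ∀ {Γ Δ Θ} → Ren Δ Θ → Ren Γ Δ → Ren Γ Θ
(r' ∘ʳ r) x = r' (r x)

≡⇒=βη : ∀ {Γ A} {t u : Tm Γ A} → t ≡ u → t =βη u
≡⇒=βη ≡.refl = refl

extR-cong : ∀ {Γ Δ A} {r r' : Ren Γ Δ} → (∀ {C} (x : Γ ∋ C) → r x ≡ r' x) →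
            ∀ {C} (x : A ∷ Γ ∋ C) → extR r x ≡ extR r' x
extR-cong e here      = ≡.refl
extR-cong e (there x) = cong there (e x)

rename-cong : ∀ {Γ Δ A} {r r' : Ren Γ Δ} → (∀ {C} (x : Γ ∋ C) → r x ≡ r' x) →
              (t : Tm Γ A) → rename r t ≡ rename r' t
rename-cong e (var x)   = cong var (e x)
rename-cong e (lam t)   = cong lam (rename-cong (extR-cong e) t)
rename-cong e (app t u) = cong₂ app (rename-cong e t) (rename-cong e u)

rename-∘ : ∀ {Γ Δ Θ A} (r : Ren Γ Δ) (r' : Ren Δ Θ) (t : Tm Γ A) →
           rename r' (rename r t) ≡ rename (r' ∘ʳ r) t
rename-∘ r r' (var x)   = ≡.refl
rename-∘ r r' (lam t)   = cong lam (≡.trans (rename-∘ (extR r) (extR r') t)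
  (rename-cong (λ { here → ≡.refl ; (there x) → ≡.refl }) t))
rename-∘ r r' (app t u) = cong₂ app (rename-∘ r r' t) (rename-∘ r r' u)

rename-id : ∀ {Γ A} {r : Ren Γ Γ} → (∀ {C} (x : Γ ∋ C) → r x ≡ x) →
            (t : Tm Γ A) → rename r t ≡ t
rename-id e (var x)   = cong var (e x)
rename-id e (lam t)   = cong lam (rename-id (λ { here → ≡.refl ; (there x) → cong there (e x) }) t)
rename-id e (app t u) = cong₂ app (rename-id e t) (rename-id e u)

exts-cong : ∀ {Γ Δ A} {σ σ' : Sub Γ Δ} → (∀ {C} (x : Γ ∋ C) → σ x ≡ σ' x) →
            ∀ {C} (x : A ∷ Γ ∋ C) → exts σ x ≡ exts σ' x
exts-cong e here      = ≡.refl
exts-cong e (there x) = cong (rename there) (e x)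

subst-cong : ∀ {Γ Δ A} {σ σ' : Sub Γ Δ} → (∀ {C} (x : Γ ∋ C) → σ x ≡ σ' x) →
             (t : Tm Γ A) → subst σ t ≡ subst σ' t
subst-cong e (var x)   = e x
subst-cong e (lam t)   = cong lam (subst-cong (exts-cong e) t)
subst-cong e (app t u) = cong₂ app (subst-cong e t) (subst-cong e u)

rename-subst : ∀ {Γ Δ Θ A} (σ : Sub Γ Δ) (r : Ren Δ Θ) (t : Tm Γ A) →
               rename r (subst σ t) ≡ subst (λ x → rename r (σ x)) t
rename-subst σ r (var x)   = ≡.refl
rename-subst σ r (lam t)   = cong lam (≡.trans (rename-subst (exts σ) (extR r) t)
  (subst-cong (λ { here → ≡.refl
                 ; (there x) → ≡.trans (rename-∘ there (extR r) (σ x))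
                                       (≡.sym (rename-∘ r there (σ x))) }) t))
rename-subst σ r (app t u) = cong₂ app (rename-subst σ r t) (rename-subst σ r u)

subst-rename : ∀ {Γ Δ Θ A} (r : Ren Γ Δ) (σ : Sub Δ Θ) (t : Tm Γ A) →
               subst σ (rename r t) ≡ subst (λ x → σ (r x)) t
subst-rename r σ (var x)   = ≡.refl
subst-rename r σ (lam t)   = cong lam (≡.trans (subst-rename (extR r) (exts σ) t)
  (subst-cong (λ { here → ≡.refl ; (there x) → ≡.refl }) t))
subst-rename r σ (app t u) = cong₂ app (subst-rename r σ t) (subst-rename r σ u)

subst-subst : ∀ {Γ Δ Θ A} (σ : Sub Γ Δ) (σ' : Sub Δ Θ) (t : Tm Γ A) →
              subst σ' (subst σ t) ≡ subst (λ x → subst σ' (σ x)) t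
subst-subst σ σ' (var x)   = ≡.refl
subst-subst σ σ' (lam t)   = cong lam (≡.trans (subst-subst (exts σ) (exts σ') t)
  (subst-cong (λ { here → ≡.refl
                 ; (there x) → ≡.trans (subst-rename there (exts σ') (σ x))
                                       (≡.sym (rename-subst σ' there (σ x))) }) t))
subst-subst σ σ' (app t u) = cong₂ app (subst-subst σ σ' t) (subst-subst σ σ' u)

subst-var : ∀ {Γ Δ A} (r : Ren Γ Δ) (t : Tm Γ A) → subst (λ x → var (r x)) t ≡ rename r t
subst-var r (var x)   = ≡.refl
subst-var r (lam t)   = cong lam (≡.trans (subst-cong (λ { here → ≡.refl ; (there x) → ≡.refl }) t)
  (subst-var (extR r) t))
subst-var r (app t u) = cong₂ app (subst-var r t) (subst-var r u)

subst-id : ∀ {Γ A} (t : Tm Γ A) → subst var t ≡ t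
subst-id t = ≡.trans (subst-var idʳ t) (rename-id (λ x → ≡.refl) t)

rename-=βη : ∀ {Γ Δ A} (r : Ren Γ Δ) {t u : Tm Γ A} → t =βη u → rename r t =βη rename r u
rename-=βη r (β t u)       = trans (β _ _) (≡⇒=βη (≡.trans (subst-rename (extR r) (single (rename r u)) t)
  (≡.trans (subst-cong (λ { here → ≡.refl ; (there x) → ≡.refl }) t)
           (≡.sym (rename-subst (single u) r t)))))
rename-=βη r (η t)         = trans (η _) (cong-lam (cong-app (≡⇒=βη
  (≡.trans (rename-∘ r there t) (≡.sym (rename-∘ there (extR r) t)))) refl))
rename-=βη r refl          = refl
rename-=βη r (sym p)       = sym (rename-=βη r p)
rename-=βη r (trans p q)   = trans (rename-=βη r p) (rename-=βη r q)
rename-=βη r (cong-lam p)  = cong-lam (rename-=βη (extR r) p)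
rename-=βη r (cong-app p q) = cong-app (rename-=βη r p) (rename-=βη r q)

there-injective : ∀ {Γ A B} {x y : Γ ∋ A} → there {B = B} x ≡ there y → x ≡ y
there-injective ≡.refl = ≡.refl

var-injective : ∀ {Γ A} {x y : Γ ∋ A} → var x ≡ var y → x ≡ y
var-injective ≡.refl = ≡.refl

lam-injective : ∀ {Γ A B} {t t' : Tm (A ∷ Γ) B} → lam t ≡ lam t' → t ≡ t'
lam-injective ≡.refl = ≡.refl

data SameApp {Γ B} : ∀ {A A'} → Tm Γ (A ⇒ B) → Tm Γ A → Tm Γ (A' ⇒ B) → Tm Γ A' → Set where
  sameApp : ∀ {A} {t t' : Tm Γ (A ⇒ B)} {u u'} → t ≡ t' → u ≡ u' → SameApp t u t' u'

app-injective : ∀ {Γ A A' B} {t : Tm Γ (A ⇒ B)} {u} {t' : Tm Γ (A' ⇒ B)} {u'} →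
                app t u ≡ app t' u' → SameApp t u t' u'
app-injective ≡.refl = sameApp ≡.refl ≡.refl

Injective : ∀ {Γ Δ} → Ren Γ Δ → Set
Injective {Γ} r = ∀ {C} {x y : Γ ∋ C} → r x ≡ r y → x ≡ y

extR-injective : ∀ {Γ Δ A} {r : Ren Γ Δ} → Injective r → Injective (extR {A = A} r)
extR-injective i {x = here}    {here}    e = ≡.refl
extR-injective i {x = here}    {there y} ()
extR-injective i {x = there x} {here}    ()
extR-injective i {x = there x} {there y} e = cong there (i (there-injective e))

rename-injective : ∀ {Γ Δ A} {r : Ren Γ Δ} → Injective r →
                   (t t' : Tm Γ A) → rename r t ≡ rename r t' → t ≡ t'
rename-injective i (var x)   (var y)     e = cong var (i (var-injective e))
rename-injective i (lam t)   (lam t')    e = cong lam (rename-injective (extR-injective i) t t' (lam-injective e))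
rename-injective i (app t u) (app t' u') e with app-injective e
... | sameApp e₁ e₂ = cong₂ app (rename-injective i t t' e₁) (rename-injective i u u' e₂)
rename-injective i (var _)   (lam _)   ()
rename-injective i (var _)   (app _ _) ()
rename-injective i (lam _)   (var _)   ()
rename-injective i (lam _)   (app _ _) ()
rename-injective i (app _ _) (var _)   ()
rename-injective i (app _ _) (lam _)   ()

-- A Kripke model of βη-equality

Val : Ctx → Ty → Set
Val Γ o       = Tm Γ o
Val Γ (A ⇒ B) = ∀ {Δ} → Ren Γ Δ → Val Δ A → Val Δ B

renV : ∀ {Γ Δ} A → Ren Γ Δ → Val Γ A → Val Δ A
renV o       r t = rename r t
renV (A ⇒ B) r f = λ r' v → f (r' ∘ʳ r) v

reify   : ∀ {Γ} A → Val Γ A → Tm Γ A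
reflect : ∀ {Γ} A → Tm Γ A → Val Γ A
reify o       t = t
reify (A ⇒ B) f = lam (reify B (f there (reflect A (var here))))
reflect o       t = t
reflect (A ⇒ B) t = λ r v → reflect B (app (rename r t) (reify A v))

-- Without function extensionality, semantic equality is a partial equivalence
-- whose domain consists of the values that commute with renaming.
ValEq   : ∀ {Γ} A → Val Γ A → Val Γ A → Set
Uniform : ∀ {Γ} A B → Val Γ (A ⇒ B) → Set
syntax ValEq A v w = v ≈[ A ] w
ValEq o       t u = t ≡ u
ValEq {Γ} (A ⇒ B) f g =
  (∀ {Δ} (r : Ren Γ Δ) {v w} → v ≈[ A ] w → f r v ≈[ B ] g r w) × Uniform A B f × Uniform A B g
Uniform {Γ} A B f = ∀ {Δ Δ'} (r : Ren Γ Δ) (r' : Ren Δ Δ') {v} → v ≈[ A ] v →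
  renV B r' (f r v) ≈[ B ] f (r' ∘ʳ r) (renV A r' v)

≈-sym : ∀ {Γ} A {v w : Val Γ A} → v ≈[ A ] w → w ≈[ A ] v
≈-sym o       e           = ≡.sym e
≈-sym (A ⇒ B) (p , u , u') = (λ r e → ≈-sym B (p r (≈-sym A e))) , u' , u

≈-trans : ∀ {Γ} A {u v w : Val Γ A} → u ≈[ A ] v → v ≈[ A ] w → u ≈[ A ] w
≈-trans o       e           e'           = ≡.trans e e'
≈-trans (A ⇒ B) (p , u , _) (q , _ , u') =
  (λ r e → ≈-trans B (p r e) (q r (≈-trans A (≈-sym A e) e))) , u , u'

≈-reflˡ : ∀ {Γ} A {v w : Val Γ A} → v ≈[ A ] w → v ≈[ A ] v
≈-reflˡ A e = ≈-trans A e (≈-sym A e)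

≈-reflʳ : ∀ {Γ} A {v w : Val Γ A} → v ≈[ A ] w → w ≈[ A ] w
≈-reflʳ A e = ≈-trans A (≈-sym A e) e

renV-cong : ∀ {Γ Δ} A (r : Ren Γ Δ) {v w : Val Γ A} → v ≈[ A ] w → renV A r v ≈[ A ] renV A r w
renV-cong o       r e            = cong (rename r) e
renV-cong (A ⇒ B) r (p , u , u') =
  (λ r' e → p (r' ∘ʳ r) e) , (λ r' r'' e → u (r' ∘ʳ r) r'' e) , (λ r' r'' e → u' (r' ∘ʳ r) r'' e)

renV-∘ : ∀ {Γ Δ Θ} A (r : Ren Γ Δ) (r' : Ren Δ Θ) {v : Val Γ A} → v ≈[ A ] v →
         renV A r' (renV A r v) ≈[ A ] renV A (r' ∘ʳ r) v
renV-∘ o       r r' {v} e = rename-∘ r r' v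
renV-∘ (A ⇒ B) r r'     e = renV-cong (A ⇒ B) (r' ∘ʳ r) e

renV-id : ∀ {Γ} A {v : Val Γ A} → v ≈[ A ] v → renV A idʳ v ≈[ A ] v
renV-id o       {v} e = rename-id (λ x → ≡.refl) v
renV-id (A ⇒ B)     e = e

reify-cong   : ∀ {Γ} A {v w : Val Γ A} → v ≈[ A ] w → reify A v ≡ reify A w
reflect-≈    : ∀ {Γ} A (t : Tm Γ A) → reflect A t ≈[ A ] reflect A t
renV-reflect : ∀ {Γ Δ} A (r : Ren Γ Δ) (t : Tm Γ A) →
               renV A r (reflect A t) ≈[ A ] reflect A (rename r t)
reify-renV   : ∀ {Γ Δ} A (r : Ren Γ Δ) {v : Val Γ A} → v ≈[ A ] v →
               reify A (renV A r v) ≡ rename r (reify A v)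

reflect-cong : ∀ {Γ} A {t u : Tm Γ A} → t ≡ u → reflect A t ≈[ A ] reflect A u
reflect-cong A {t} ≡.refl = reflect-≈ A t

reify-cong o       e       = e
reify-cong (A ⇒ B) (p , _) = cong lam (reify-cong B (p there (reflect-≈ A (var here))))

reflect-≈ o       t = ≡.refl
reflect-≈ (A ⇒ B) t = pointwise , uniform , uniform
  where
  pointwise : ∀ {Δ} (r : Ren _ Δ) {v w} → v ≈[ A ] w →
              reflect B (app (rename r t) (reify A v)) ≈[ B ] reflect B (app (rename r t) (reify A w))
  pointwise r e = reflect-cong B (cong (app (rename r t)) (reify-cong A e))
  uniform : Uniform A B (reflect (A ⇒ B) t)
  uniform r r' {v} e = ≈-trans B (renV-reflect B r' (app (rename r t) (reify A v)))
    (reflect-cong B (cong₂ app (rename-∘ r r' t) (≡.sym (reify-renV A r' e))))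

renV-reflect o       r t = ≡.refl
renV-reflect (A ⇒ B) r t =
  (λ r' e → reflect-cong B (cong₂ app (≡.sym (rename-∘ r r' t)) (reify-cong A e)))
  , proj₁ (proj₂ (renV-cong (A ⇒ B) r (reflect-≈ (A ⇒ B) t)))
  , proj₁ (proj₂ (reflect-≈ (A ⇒ B) (rename r t)))

reify-renV o       r e           = ≡.refl
reify-renV (A ⇒ B) r {f} (p , u , _) = cong lam (begin
  reify B (f (there ∘ʳ r) q)
    ≡⟨ reify-cong B (p (there ∘ʳ r) (≈-sym A (renV-reflect A (extR r) (var here)))) ⟩
  reify B (f (extR r ∘ʳ there) (renV A (extR r) q))
    ≡⟨ reify-cong B (≈-sym B (u there (extR r) (reflect-≈ A (var here)))) ⟩
  reify B (renV B (extR r) (f there q))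
    ≡⟨ reify-renV B (extR r) (p there (reflect-≈ A (var here))) ⟩
  rename (extR r) (reify B (f there q))
    ∎)
  where
  q : ∀ {Θ} → Val (A ∷ Θ) A
  q = reflect A (var here)

Env : Ctx → Ctx → Set
Env Γ Δ = ∀ {C} → Γ ∋ C → Val Δ C

infix 4 _≈ᴱ_
_≈ᴱ_ : ∀ {Γ Δ} → Env Γ Δ → Env Γ Δ → Set
_≈ᴱ_ {Γ} ρ ρ' = ∀ {C} (x : Γ ∋ C) → ρ x ≈[ C ] ρ' x

infixr 5 _∷ᴱ_
_∷ᴱ_ : ∀ {Γ Δ A} → Val Δ A → Env Γ Δ → Env (A ∷ Γ) Δ
(v ∷ᴱ ρ) here      = v
(v ∷ᴱ ρ) (there x) = ρ x

renE : ∀ {Γ Δ Θ} → Ren Δ Θ → Env Γ Δ → Env Γ Θ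
renE r ρ {C} x = renV C r (ρ x)

eval : ∀ {Γ Δ A} → Tm Γ A → Env Γ Δ → Val Δ A
eval (var x)   ρ = ρ x
eval (lam t)   ρ = λ r v → eval t (v ∷ᴱ renE r ρ)
eval (app t u) ρ = eval t ρ idʳ (eval u ρ)

≈ᴱ-∷ : ∀ {Γ Δ A} {v w : Val Δ A} {ρ ρ' : Env Γ Δ} → v ≈[ A ] w → ρ ≈ᴱ ρ' → v ∷ᴱ ρ ≈ᴱ w ∷ᴱ ρ'
≈ᴱ-∷ e e' here      = e
≈ᴱ-∷ e e' (there x) = e' x

renE-cong : ∀ {Γ Δ Θ} (r : Ren Δ Θ) {ρ ρ' : Env Γ Δ} → ρ ≈ᴱ ρ' → renE r ρ ≈ᴱ renE r ρ'
renE-cong r e {C} x = renV-cong C r (e x)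

≈ᴱ-sym : ∀ {Γ Δ} {ρ ρ' : Env Γ Δ} → ρ ≈ᴱ ρ' → ρ' ≈ᴱ ρ
≈ᴱ-sym e {C} x = ≈-sym C (e x)

≈ᴱ-reflˡ : ∀ {Γ Δ} {ρ ρ' : Env Γ Δ} → ρ ≈ᴱ ρ' → ρ ≈ᴱ ρ
≈ᴱ-reflˡ e {C} x = ≈-reflˡ C (e x)

≈ᴱ-reflʳ : ∀ {Γ Δ} {ρ ρ' : Env Γ Δ} → ρ ≈ᴱ ρ' → ρ' ≈ᴱ ρ'
≈ᴱ-reflʳ e {C} x = ≈-reflʳ C (e x)

eval-cong        : ∀ {Γ Δ A} (t : Tm Γ A) {ρ ρ' : Env Γ Δ} → ρ ≈ᴱ ρ' → eval t ρ ≈[ A ] eval t ρ'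
renV-eval        : ∀ {Γ Δ Θ A} (t : Tm Γ A) (r : Ren Δ Θ) {ρ ρ' : Env Γ Δ} → ρ ≈ᴱ ρ' →
                   renV A r (eval t ρ) ≈[ A ] eval t (renE r ρ')
eval-lam-uniform : ∀ {Γ Δ A B} (t : Tm (A ∷ Γ) B) {ρ : Env Γ Δ} → ρ ≈ᴱ ρ → Uniform A B (eval (lam t) ρ)

eval-lam-uniform {A = A} {B} t e r r' ev =
  ≈-trans B (renV-eval t r' (≈ᴱ-∷ ev (renE-cong r e)))
    (eval-cong t (λ { here → renV-cong A r' ev ; (there {A = C} x) → renV-∘ C r r' (e x) }))

eval-cong (var x)   e = e x
eval-cong (app t u) e = proj₁ (eval-cong t e) idʳ (eval-cong u e)
eval-cong (lam t)   e =
  (λ r ev → eval-cong t (≈ᴱ-∷ ev (renE-cong r e)))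
  , eval-lam-uniform t (≈ᴱ-reflˡ e) , eval-lam-uniform t (≈ᴱ-reflʳ e)

renV-eval {A = A} (var x) r e = renV-cong A r (e x)
renV-eval {A = B} (app t u) r e =
  ≈-trans B (proj₁ (proj₂ (eval-cong t (≈ᴱ-reflˡ e))) idʳ r (eval-cong u (≈ᴱ-reflˡ e)))
    (proj₁ (renV-eval t r e) idʳ (renV-eval u r e))
renV-eval (lam {A = A} {B} t) r e =
  (λ r' ev → eval-cong t (≈ᴱ-∷ ev (λ {C} x → ≈-trans C (renV-cong C (r' ∘ʳ r) (e x))
                                                  (≈-sym C (renV-∘ C r r' (≈ᴱ-reflʳ e x))))))
  , proj₁ (proj₂ (renV-cong (A ⇒ B) r (eval-cong (lam t) e)))
  , proj₂ (proj₂ (eval-cong (lam t) (renE-cong r (≈ᴱ-reflʳ e))))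

eval-rename : ∀ {Γ Γ' Δ A} (s : Ren Γ Γ') (t : Tm Γ A) {ρ : Env Γ' Δ} {τ : Env Γ Δ} →
  ρ ≈ᴱ ρ → τ ≈ᴱ τ → (∀ {C} (x : Γ ∋ C) → ρ (s x) ≈[ C ] τ x) →
  eval (rename s t) ρ ≈[ A ] eval t τ
eval-rename s (var x)   sρ sτ h = h x
eval-rename s (app t u) sρ sτ h = proj₁ (eval-rename s t sρ sτ h) idʳ (eval-rename s u sρ sτ h)
eval-rename s (lam t)   sρ sτ h =
  (λ r ev → eval-rename (extR s) t (≈ᴱ-∷ (≈-reflˡ _ ev) (renE-cong r sρ))
       (≈ᴱ-∷ (≈-reflʳ _ ev) (renE-cong r sτ))
       (λ { here → ev ; (there {A = C} x) → renV-cong C r (h x) }))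
  , eval-lam-uniform (rename (extR s) t) sρ , eval-lam-uniform t sτ

eval-subst : ∀ {Γ Γ' Δ A} (σ : Sub Γ Γ') (t : Tm Γ A) {ρ : Env Γ' Δ} {τ : Env Γ Δ} →
  ρ ≈ᴱ ρ → τ ≈ᴱ τ → (∀ {C} (x : Γ ∋ C) → eval (σ x) ρ ≈[ C ] τ x) →
  eval (subst σ t) ρ ≈[ A ] eval t τ
eval-subst σ (var x)   sρ sτ h = h x
eval-subst σ (app t u) sρ sτ h = proj₁ (eval-subst σ t sρ sτ h) idʳ (eval-subst σ u sρ sτ h)
eval-subst σ (lam t)   sρ sτ h =
  (λ r ev → eval-subst (exts σ) t (≈ᴱ-∷ (≈-reflˡ _ ev) (renE-cong r sρ))
       (≈ᴱ-∷ (≈-reflʳ _ ev) (renE-cong r sτ))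
       (λ { here → ev
          ; (there {A = C} x) → ≈-trans C
              (eval-rename there (σ x) (≈ᴱ-∷ (≈-reflˡ _ ev) (renE-cong r sρ)) (renE-cong r sρ)
                 (λ {D} y → renV-cong D r (sρ y)))
              (≈-trans C (≈-sym C (renV-eval (σ x) r sρ)) (renV-cong C r (h x))) }))
  , eval-lam-uniform (subst (exts σ) t) sρ , eval-lam-uniform t sτ

eval-=βη : ∀ {Γ Δ A} {t u : Tm Γ A} → t =βη u →
           {ρ ρ' : Env Γ Δ} → ρ ≈ᴱ ρ' → eval t ρ ≈[ A ] eval u ρ'
eval-=βη {A = B} (β {A = A} t u) {ρ} {ρ'} e =
  ≈-trans B (eval-cong t {ρ' = eval u ρ' ∷ᴱ ρ'}
      (λ { here → eval-cong u e ; (there {A = C} x) → ≈-trans C (renV-id C (≈ᴱ-reflˡ e x)) (e x) }))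
    (≈-sym B (eval-subst (single u) t (≈ᴱ-reflʳ e) (≈ᴱ-∷ (eval-cong u (≈ᴱ-reflʳ e)) (≈ᴱ-reflʳ e))
      (λ { here → eval-cong u (≈ᴱ-reflʳ e) ; (there x) → ≈ᴱ-reflʳ e x })))
eval-=βη (η {A = A} {B} t) e =
  (λ r ev → ≈-trans B (proj₁ (renV-eval t r e) idʳ ev)
      (proj₁ (≈-sym (A ⇒ B) (eval-rename there t (≈ᴱ-∷ (≈-reflʳ A ev) (renE-cong r (≈ᴱ-reflʳ e)))
         (renE-cong r (≈ᴱ-reflʳ e)) (λ {C} x → renV-cong C r (≈ᴱ-reflʳ e x)))) idʳ (≈-reflʳ A ev)))
  , proj₁ (proj₂ (eval-cong t (≈ᴱ-reflˡ e)))
  , proj₂ (proj₂ (eval-cong (lam (app (rename there t) (var here))) (≈ᴱ-reflʳ e)))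
eval-=βη (refl {t = t}) e = eval-cong t e
eval-=βη {A = A} (sym p)     e = ≈-sym A (eval-=βη p (≈ᴱ-sym e))
eval-=βη {A = A} (trans p q) e = ≈-trans A (eval-=βη p e) (eval-=βη q (≈ᴱ-reflʳ e))
eval-=βη (cong-lam {t = t} {t′} p) e =
  (λ r ev → eval-=βη p (≈ᴱ-∷ ev (renE-cong r e)))
  , eval-lam-uniform t (≈ᴱ-reflˡ e) , eval-lam-uniform t′ (≈ᴱ-reflʳ e)
eval-=βη (cong-app p q) e = proj₁ (eval-=βη p e) idʳ (eval-=βη q e)

idEnv : ∀ {Γ} → Env Γ Γ
idEnv {C = C} x = reflect C (var x)

idEnv-≈ : ∀ {Γ} → idEnv {Γ} ≈ᴱ idEnv
idEnv-≈ {C = C} x = reflect-≈ C (var x)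

nf : ∀ {Γ A} → Tm Γ A → Tm Γ A
nf {A = A} t = reify A (eval t idEnv)

nf-cong : ∀ {Γ A} {t u : Tm Γ A} → t =βη u → nf t ≡ nf u
nf-cong {A = A} p = reify-cong A (eval-=βη p idEnv-≈)

-- Soundness of normalisation

Related : ∀ {Γ} A → Tm Γ A → Val Γ A → Set
syntax Related A t v = t ∼[ A ] v
Related o       t v = t =βη v
Related {Γ} (A ⇒ B) t f = ∀ {Δ} (r : Ren Γ Δ) {s v} → s ∼[ A ] v → app (rename r t) s ∼[ B ] f r v

∼-=βη : ∀ {Γ} A {t t' : Tm Γ A} {v} → t =βη t' → t ∼[ A ] v → t' ∼[ A ] v
∼-=βη o       p h      = trans (sym p) h
∼-=βη (A ⇒ B) p h r hs = ∼-=βη B (cong-app (rename-=βη r p) refl) (h r hs)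

∼-rename : ∀ {Γ Δ} A (r : Ren Γ Δ) {t v} → t ∼[ A ] v → rename r t ∼[ A ] renV A r v
∼-rename o       r     h      = rename-=βη r h
∼-rename (A ⇒ B) r {t} h r' hs =
  ∼-=βη B (cong-app (≡⇒=βη (≡.sym (rename-∘ r r' t))) refl) (h (r' ∘ʳ r) hs)

∼-reify   : ∀ {Γ} A {t : Tm Γ A} {v} → t ∼[ A ] v → t =βη reify A v
∼-reflect : ∀ {Γ} A (t : Tm Γ A) → t ∼[ A ] reflect A t
∼-reify o           h = h
∼-reify (A ⇒ B) {t} h = trans (η t) (cong-lam (∼-reify B (h there (∼-reflect A (var here)))))
∼-reflect o       t      = refl
∼-reflect (A ⇒ B) t r hs =
  ∼-=βη B (cong-app refl (sym (∼-reify A hs))) (∼-reflect B (app (rename r t) (reify A _)))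

infixr 5 _∷ˢ_
_∷ˢ_ : ∀ {Γ Δ A} → Tm Δ A → Sub Γ Δ → Sub (A ∷ Γ) Δ
(s ∷ˢ σ) here      = s
(s ∷ˢ σ) (there x) = σ x

subst-∼-eval : ∀ {Γ Δ A} (t : Tm Γ A) {σ : Sub Γ Δ} {ρ : Env Γ Δ} →
  (∀ {C} (x : Γ ∋ C) → σ x ∼[ C ] ρ x) → subst σ t ∼[ A ] eval t ρ
subst-∼-eval (var x) h = h x
subst-∼-eval {A = B} (app t u) {σ} h =
  ∼-=βη B (cong-app (≡⇒=βη (rename-id (λ x → ≡.refl) (subst σ t))) refl)
    (subst-∼-eval t h idʳ (subst-∼-eval u h))
subst-∼-eval (lam {A = A} {B} t) {σ} {ρ} h r {s} {v} hs =
  ∼-=βη B (sym (trans (β _ s) (≡⇒=βη β-reduct)))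
    (subst-∼-eval t {σ = s ∷ˢ (λ x → rename r (σ x))} {ρ = v ∷ᴱ renE r ρ}
      (λ { here → hs ; (there {A = C} x) → ∼-rename C r (h x) }))
  where
  β-reduct : subst (single s) (rename (extR r) (subst (exts σ) t)) ≡ subst (s ∷ˢ (λ x → rename r (σ x))) t
  β-reduct = ≡.trans (subst-rename (extR r) (single s) (subst (exts σ) t))
    (≡.trans (subst-subst (exts σ) _ t)
      (subst-cong (λ { here → ≡.refl
                     ; (there x) → ≡.trans (subst-rename there _ (σ x)) (subst-var r (σ x)) }) t))

nf-sound : ∀ {Γ A} (t : Tm Γ A) → t =βη nf t
nf-sound {A = A} t =
  ∼-reify A (∼-=βη A (≡⇒=βη (subst-id t)) (subst-∼-eval t (λ {C} x → ∼-reflect C (var x))))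

-- Spines

data VArgs (Δ : Ctx) : List Ty → Set where
  []  : VArgs Δ []
  _∷_ : ∀ {A As} → Val Δ A → VArgs Δ As → VArgs Δ (A ∷ As)

infix 4 _≈ᴬ_
_≈ᴬ_ : ∀ {Δ As} → VArgs Δ As → VArgs Δ As → Set
[]              ≈ᴬ []      = ⊤
(_∷_ {A} v V)   ≈ᴬ (w ∷ W) = v ≈[ A ] w × V ≈ᴬ W

appsV : ∀ {Δ} A → Val Δ A → VArgs Δ (args A) → Val Δ o
appsV o       v []      = v
appsV (A ⇒ B) f (w ∷ W) = appsV B (f idʳ w) W

evalArgs : ∀ {Γ Δ As} → Args Γ As → Env Γ Δ → VArgs Δ As
evalArgs []      ρ = []
evalArgs (m ∷ M) ρ = eval m ρ ∷ evalArgs M ρ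

evalArgs-cong : ∀ {Γ Δ As} (M : Args Γ As) {ρ ρ' : Env Γ Δ} → ρ ≈ᴱ ρ' → evalArgs M ρ ≈ᴬ evalArgs M ρ'
evalArgs-cong []      e = tt
evalArgs-cong (m ∷ M) e = eval-cong m e , evalArgs-cong M e

reifyArgs : ∀ {Δ As} → VArgs Δ As → Args Δ As
reifyArgs []            = []
reifyArgs (_∷_ {A} v V) = reify A v ∷ reifyArgs V

nfArgs : ∀ {Δ As} → Args Δ As → Args Δ As
nfArgs M = reifyArgs (evalArgs M idEnv)

eval-apps : ∀ {Γ Δ A} (t : Tm Γ A) (M : Args Γ (args A)) (ρ : Env Γ Δ) →
            eval (apps t M) ρ ≡ appsV A (eval t ρ) (evalArgs M ρ)
eval-apps {A = o}     t []      ρ = ≡.refl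
eval-apps {A = A ⇒ B} t (m ∷ M) ρ = eval-apps (app t m) M ρ

appsV-cong : ∀ {Δ} A {v v' : Val Δ A} {W W'} → v ≈[ A ] v' → W ≈ᴬ W' → appsV A v W ≡ appsV A v' W'
appsV-cong o       {W = []}    {[]}      e       _        = e
appsV-cong (A ⇒ B) {W = w ∷ W} {w' ∷ W'} (p , _) (e , es) = appsV-cong B (p idʳ e) es

appsV-reflect : ∀ {Δ} A (n : Tm Δ A) (W : VArgs Δ (args A)) →
                appsV A (reflect A n) W ≡ apps n (reifyArgs W)
appsV-reflect o       n []      = ≡.refl
appsV-reflect (A ⇒ B) n (w ∷ W) =
  ≡.trans (appsV-reflect B _ W)
          (cong (λ n' → apps (app n' (reify A w)) (reifyArgs W)) (rename-id (λ x → ≡.refl) n))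

∷-injective : ∀ {Δ A As} {m n : Tm Δ A} {M N : Args Δ As} →
              _≡_ {A = Args Δ (A ∷ As)} (m ∷ M) (n ∷ N) → m ≡ n × M ≡ N
∷-injective ≡.refl = ≡.refl , ≡.refl

nfArgs-injective : ∀ {Δ As} (M N : Args Δ As) → nfArgs M ≡ nfArgs N → ArgsEq M N
nfArgs-injective []      []      e = []
nfArgs-injective (m ∷ M) (n ∷ N) e =
  trans (nf-sound m) (trans (≡⇒=βη (proj₁ (∷-injective e))) (sym (nf-sound n)))
  ∷ nfArgs-injective M N (proj₂ (∷-injective e))

spineLength : ∀ {Γ A} → Tm Γ A → ℕ
spineLength (app t u) = suc (spineLength t)
spineLength _         = 0

spineLength-apps : ∀ {Γ A} (t : Tm Γ A) (M : Args Γ (args A)) →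
                   spineLength (apps t M) ≡ length (args A) + spineLength t
spineLength-apps {A = o}     t []      = ≡.refl
spineLength-apps {A = A ⇒ B} t (m ∷ M) = ≡.trans (spineLength-apps (app t m) M) (+-suc _ _)

data SameApps {Θ} : ∀ {A B} → Tm Θ A → Tm Θ B → Args Θ (args A) → Args Θ (args B) → Set where
  sameApps : ∀ {A} {t : Tm Θ A} {M} → SameApps t t M M

apps-injective : ∀ {Θ A B} (t : Tm Θ A) (t' : Tm Θ B) M N → length (args A) ≡ length (args B) →
                 apps t M ≡ apps t' N → SameApps t t' M N
apps-injective {A = o}     {o}     t t' []      []      l ≡.refl = sameApps
apps-injective {A = A ⇒ _} {B ⇒ _} t t' (m ∷ M) (n ∷ N) l e
  with apps-injective (app t m) (app t' n) M N (suc-injective l) e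
... | sameApps = sameApps
apps-injective {A = o}     {_ ⇒ _} t t' [] (n ∷ N) () e
apps-injective {A = _ ⇒ _} {o}     t t' (m ∷ M) [] () e

data SameVar {Θ} : ∀ {A B} → Θ ∋ A → Θ ∋ B → Args Θ (args A) → Args Θ (args B) → Set where
  sameVar : ∀ {A} {c c' : Θ ∋ A} {M M'} → c ≡ c' → M ≡ M' → SameVar c c' M M'

apps-var-injective : ∀ {Θ A B} (c : Θ ∋ A) (c' : Θ ∋ B) M N →
                     apps (var c) M ≡ apps (var c') N → SameVar c c' M N
apps-var-injective {A = A} {B} c c' M N e with apps-injective (var c) (var c') M N arity e
  where
  arity : length (args A) ≡ length (args B)
  arity = begin
    length (args A)                  ≡⟨ ≡.sym (+-identityʳ _) ⟩
    length (args A) + 0              ≡⟨ ≡.sym (spineLength-apps (var c) M) ⟩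
    spineLength (apps (var c) M)     ≡⟨ cong spineLength e ⟩
    spineLength (apps (var c') N)    ≡⟨ spineLength-apps (var c') N ⟩
    length (args B) + 0              ≡⟨ +-identityʳ _ ⟩
    length (args B)                  ∎
... | sameApps = sameVar ≡.refl ≡.refl

-- Binding a list of variables at once

infixl 5 _,*_
_,*_ : Ctx → List Ty → Ctx
Γ ,* []       = Γ
Γ ,* (C ∷ Cs) = (C ∷ Γ) ,* Cs

wk* : ∀ Cs {Γ D} → Γ ∋ D → Γ ,* Cs ∋ D
wk* []       v = v
wk* (C ∷ Cs) v = wk* Cs (there v)

bound : ∀ Cs {Γ D} → Cs ∋ D → Γ ,* Cs ∋ D
bound (C ∷ Cs) here      = wk* Cs here
bound (C ∷ Cs) (there j) = bound Cs j

lam* : ∀ C {Γ} → Tm (Γ ,* args C) o → Tm Γ C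
lam* o         t = t
lam* (C₁ ⇒ C₂) t = lam (lam* C₂ t)

varArgs : ∀ Cs {Θ} → (∀ {D} → Cs ∋ D → Θ ∋ D) → Args Θ Cs
varArgs []       g = []
varArgs (C ∷ Cs) g = var (g here) ∷ varArgs Cs (λ j → g (there j))

rename* : ∀ Cs {Θ D} → Tm Θ D → Tm (Θ ,* Cs) D
rename* []       t = t
rename* (C ∷ Cs) t = rename* Cs (rename there t)

renameArgs* : ∀ Cs {Θ Ds} → Args Θ Ds → Args (Θ ,* Cs) Ds
renameArgs* Cs []      = []
renameArgs* Cs (m ∷ M) = rename* Cs m ∷ renameArgs* Cs M

wk*-injective : ∀ Cs {Γ D} {v w : Γ ∋ D} → wk* Cs v ≡ wk* Cs w → v ≡ w
wk*-injective []       e = e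
wk*-injective (C ∷ Cs) e = there-injective (wk*-injective Cs e)

wk*≢bound : ∀ Cs {Γ D} (v : Γ ∋ D) (j : Cs ∋ D) → wk* Cs v ≡ bound Cs j → ⊥
wk*≢bound (C ∷ Cs) v here e with wk*-injective Cs e
... | ()
wk*≢bound (C ∷ Cs) v (there j) e = wk*≢bound Cs (there v) j e

bound-injective : ∀ Cs {Γ D} {j k : Cs ∋ D} → bound Cs {Γ} j ≡ bound Cs k → j ≡ k
bound-injective (C ∷ Cs) {j = here}    {here}    e = ≡.refl
bound-injective (C ∷ Cs) {j = here}    {there k} e = ⊥-elim (wk*≢bound Cs here k e)
bound-injective (C ∷ Cs) {j = there j} {here}    e = ⊥-elim (wk*≢bound Cs here j (≡.sym e))
bound-injective (C ∷ Cs) {j = there j} {there k} e = cong there (bound-injective Cs e)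

lam*-injective : ∀ C {Γ} {t t' : Tm (Γ ,* args C) o} → lam* C t ≡ lam* C t' → t ≡ t'
lam*-injective o         e = e
lam*-injective (C₁ ⇒ C₂) e = lam*-injective C₂ (lam-injective e)

rename*-injective : ∀ Cs {Θ D} {t t' : Tm Θ D} → rename* Cs t ≡ rename* Cs t' → t ≡ t'
rename*-injective []                  e = e
rename*-injective (C ∷ Cs) {t = t} {t'} e = rename-injective there-injective t t' (rename*-injective Cs e)

renameArgs*-injective : ∀ Cs {Θ Ds} (M N : Args Θ Ds) → renameArgs* Cs M ≡ renameArgs* Cs N → M ≡ N
renameArgs*-injective Cs []      []      e = ≡.refl
renameArgs*-injective Cs (m ∷ M) (n ∷ N) e =
  cong₂ _∷_ (rename*-injective Cs (proj₁ (∷-injective e)))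
            (renameArgs*-injective Cs M N (proj₂ (∷-injective e)))

extendEnv : ∀ Cs {Γ Θ} → Env Γ Θ → VArgs Θ Cs → Env (Γ ,* Cs) Θ
extendEnv []       ρ []      = ρ
extendEnv (C ∷ Cs) ρ (w ∷ W) = extendEnv Cs (w ∷ᴱ ρ) W

extendEnv-cong : ∀ Cs {Γ Θ} {ρ ρ' : Env Γ Θ} {W W'} → ρ ≈ᴱ ρ' → W ≈ᴬ W' →
                 extendEnv Cs ρ W ≈ᴱ extendEnv Cs ρ' W'
extendEnv-cong []       {W = []}    {[]}      e _        = e
extendEnv-cong (C ∷ Cs) {W = w ∷ W} {w' ∷ W'} e (ew , es) = extendEnv-cong Cs (≈ᴱ-∷ ew e) es

extendEnv-wk* : ∀ Cs {Γ Θ D} (ρ : Env Γ Θ) W (v : Γ ∋ D) → extendEnv Cs ρ W (wk* Cs v) ≡ ρ v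
extendEnv-wk* []       ρ []      v = ≡.refl
extendEnv-wk* (C ∷ Cs) ρ (w ∷ W) v = extendEnv-wk* Cs (w ∷ᴱ ρ) W (there v)

renV* : ∀ Cs {Θ} D → Val Θ D → Val (Θ ,* Cs) D
renV* []       D v = v
renV* (C ∷ Cs) D v = renV* Cs D (renV D there v)

renV*-cong : ∀ Cs {Θ} D {v w : Val Θ D} → v ≈[ D ] w → renV* Cs D v ≈[ D ] renV* Cs D w
renV*-cong []       D e = e
renV*-cong (C ∷ Cs) D e = renV*-cong Cs D (renV-cong D there e)

reify-renV* : ∀ Cs {Θ} D {v : Val Θ D} → v ≈[ D ] v → reify D (renV* Cs D v) ≡ rename* Cs (reify D v)
reify-renV* []       D e = ≡.refl
reify-renV* (C ∷ Cs) D e =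
  ≡.trans (reify-renV* Cs D (renV-cong D there e)) (cong (rename* Cs) (reify-renV D there e))

renV*-reflect : ∀ Cs {Θ} D (v : Θ ∋ D) → renV* Cs D (reflect D (var v)) ≈[ D ] reflect D (var (wk* Cs v))
renV*-reflect []       D v = reflect-≈ D (var v)
renV*-reflect (C ∷ Cs) D v =
  ≈-trans D (renV*-cong Cs D (renV-reflect D there (var v))) (renV*-reflect Cs D (there v))

liftEnv* : ∀ Cs {Γ Θ} → Env Γ Θ → Env (Γ ,* Cs) (Θ ,* Cs)
liftEnv* []       ρ = ρ
liftEnv* (C ∷ Cs) ρ = liftEnv* Cs (reflect C (var here) ∷ᴱ renE there ρ)

liftEnv*-cong : ∀ Cs {Γ Θ} {ρ ρ' : Env Γ Θ} → ρ ≈ᴱ ρ' → liftEnv* Cs ρ ≈ᴱ liftEnv* Cs ρ'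
liftEnv*-cong []       e = e
liftEnv*-cong (C ∷ Cs) e = liftEnv*-cong Cs (≈ᴱ-∷ (reflect-≈ C (var here)) (renE-cong there e))

liftEnv*-wk* : ∀ Cs {Γ Θ D} (ρ : Env Γ Θ) (v : Γ ∋ D) → liftEnv* Cs ρ (wk* Cs v) ≡ renV* Cs D (ρ v)
liftEnv*-wk* []       ρ v = ≡.refl
liftEnv*-wk* (C ∷ Cs) ρ v = liftEnv*-wk* Cs _ (there v)

liftEnv*-bound : ∀ Cs {Γ Θ D} (ρ : Env Γ Θ) (j : Cs ∋ D) → ρ ≈ᴱ ρ →
                 liftEnv* Cs ρ (bound Cs j) ≈[ D ] reflect D (var (bound Cs j))
liftEnv*-bound (C ∷ Cs) {D = D} ρ here e =
  ≡.subst (λ v → v ≈[ D ] reflect D (var (wk* Cs here))) (≡.sym (liftEnv*-wk* Cs _ here))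
    (renV*-reflect Cs D here)
liftEnv*-bound (C ∷ Cs) ρ (there j) e =
  liftEnv*-bound Cs _ j (≈ᴱ-∷ (reflect-≈ C (var here)) (renE-cong there e))

reify-lam* : ∀ C {Γ Θ} (t : Tm (Γ ,* args C) o) (ρ : Env Γ Θ) →
             reify C (eval (lam* C t) ρ) ≡ lam* C (eval t (liftEnv* (args C) ρ))
reify-lam* o         t ρ = ≡.refl
reify-lam* (C₁ ⇒ C₂) t ρ = cong lam (reify-lam* C₂ t _)

appsV-lam* : ∀ C {Γ Θ} (t : Tm (Γ ,* args C) o) (ρ : Env Γ Θ) W → ρ ≈ᴱ ρ → W ≈ᴬ W →
             appsV C (eval (lam* C t) ρ) W ≡ eval t (extendEnv (args C) ρ W)
appsV-lam* o         t ρ []      e _         = ≡.refl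
appsV-lam* (C₁ ⇒ C₂) t ρ (w ∷ W) e (ew , es) =
  ≡.trans (appsV-lam* C₂ t _ W (≈ᴱ-∷ ew (renE-cong idʳ e)) es)
    (eval-cong t (extendEnv-cong (args C₂) (≈ᴱ-∷ ew (λ {C} x → renV-id C (e x))) es))

boundArgs : ∀ As Cs {Γ} → Args (Γ ,* Cs ,* As) Cs
boundArgs As Cs = varArgs Cs (λ j → wk* As (bound Cs j))

reifyArgs-eval-boundArgs : ∀ As Cs {Γ Θ} (ρ : Env Γ Θ) (W : VArgs Θ Cs) → W ≈ᴬ W →
  reifyArgs (evalArgs (boundArgs As Cs) (liftEnv* As (extendEnv Cs ρ W))) ≡ renameArgs* As (reifyArgs W)
reifyArgs-eval-boundArgs As []       ρ []      _         = ≡.refl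
reifyArgs-eval-boundArgs As (C ∷ Cs) ρ (w ∷ W) (ew , es) = cong₂ _∷_
  (≡.trans (cong (reify C) (≡.trans (liftEnv*-wk* As _ (wk* Cs here))
                                    (cong (renV* As C) (extendEnv-wk* Cs (w ∷ᴱ ρ) W here))))
           (reify-renV* As C ew))
  (reifyArgs-eval-boundArgs As Cs (w ∷ᴱ ρ) W es)

-- The reduction from A to [[A]]

ϱ : ∀ A {C} → args A ∋ C → Tm ((A ⇒ o) ∷ []) C
ϱ A {C} x =
  lam* C (app (var (wk* (args C) here)) (lam* A (apps (var (bound (args A) x)) (boundArgs (args A) (args C)))))

injL : ∀ Ξ {Γ C} → Ξ ∋ C → Ξ ++ Γ ∋ C
injL (D ∷ Ξ) here      = here
injL (D ∷ Ξ) (there y) = there (injL Ξ y)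

injR : ∀ Ξ {Γ C} → Γ ∋ C → Ξ ++ Γ ∋ C
injR []      x = x
injR (D ∷ Ξ) x = there (injR Ξ x)

data View (Ξ : Ctx) {Γ : Ctx} : ∀ {C} → Ξ ++ Γ ∋ C → Set where
  isL : ∀ {C} (y : Ξ ∋ C) → View Ξ (injL Ξ y)
  isR : ∀ {C} (x : Γ ∋ C) → View Ξ (injR Ξ x)

view : ∀ Ξ {Γ C} (a : Ξ ++ Γ ∋ C) → View Ξ a
view []      a         = isR a
view (D ∷ Ξ) here      = isL here
view (D ∷ Ξ) (there a) with view Ξ a
... | isL y = isL (there y)
... | isR x = isR x

injL-injective : ∀ Ξ {Γ C} {y y' : Ξ ∋ C} → injL Ξ {Γ} y ≡ injL Ξ y' → y ≡ y'
injL-injective (D ∷ Ξ) {y = here}    {here}     e = ≡.refl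
injL-injective (D ∷ Ξ) {y = there y} {there y'} e = cong there (injL-injective Ξ (there-injective e))
injL-injective (D ∷ Ξ) {y = here}    {there y'} ()
injL-injective (D ∷ Ξ) {y = there y} {here}     ()

injL≢injR : ∀ Ξ {Γ C} {y : Ξ ∋ C} {x : Γ ∋ C} → injL Ξ y ≡ injR Ξ x → ⊥
injL≢injR (D ∷ Ξ) {y = here}    ()
injL≢injR (D ∷ Ξ) {y = there y} e = injL≢injR Ξ (there-injective e)

lift-injL : ∀ Ξ {Γ Δ C} (σ : Sub Γ Δ) (y : Ξ ∋ C) → lift Ξ σ (injL Ξ {Γ} y) ≡ var (injL Ξ y)
lift-injL (D ∷ Ξ) σ here      = ≡.refl
lift-injL (D ∷ Ξ) σ (there y) = cong (rename there) (lift-injL Ξ σ y)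

eval-lift-injR : ∀ Ξ {Γ Δ Θ C} (σ : Sub Γ Δ) (x : Γ ∋ C) {ρ : Env (Ξ ++ Δ) Θ} → ρ ≈ᴱ ρ →
                 eval (lift Ξ σ (injR Ξ x)) ρ ≈[ C ] eval (σ x) (λ y → ρ (injR Ξ y))
eval-lift-injR []      σ x e = eval-cong (σ x) e
eval-lift-injR (D ∷ Ξ) {C = C} σ x e =
  ≈-trans C (eval-rename there (lift Ξ σ (injR Ξ x)) e (λ y → e (there y)) (λ y → e (there y)))
            (eval-lift-injR Ξ σ x (λ y → e (there y)))

nf-lift-injL : ∀ Ξ {Γ Δ C} (σ : Sub Γ Δ) (y : Ξ ∋ C) (M : Args (Ξ ++ Δ) (args C)) →
               nf (apps (lift Ξ σ (injL Ξ y)) M) ≡ apps (var (injL Ξ y)) (nfArgs M)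
nf-lift-injL Ξ {C = C} σ y M = begin
  nf (apps (lift Ξ σ (injL Ξ y)) M)
    ≡⟨ cong (λ h → nf (apps h M)) (lift-injL Ξ σ y) ⟩
  nf (apps (var (injL Ξ y)) M)
    ≡⟨ eval-apps (var _) M idEnv ⟩
  appsV C (reflect C (var (injL Ξ y))) (evalArgs M idEnv)
    ≡⟨ appsV-reflect C (var _) (evalArgs M idEnv) ⟩
  apps (var (injL Ξ y)) (nfArgs M)
    ∎

nf-lift-injR : ∀ Ξ A {C} (x : args A ∋ C) (M : Args (Ξ ++ ((A ⇒ o) ∷ [])) (args C)) →
  nf (apps (lift Ξ (ϱ A) (injR Ξ x)) M)
  ≡ app (var (injR Ξ here)) (lam* A (apps (var (bound (args A) x)) (renameArgs* (args A) (nfArgs M))))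
nf-lift-injR Ξ A {C} x M = begin
  nf (apps (lift Ξ (ϱ A) (injR Ξ x)) M)
    ≡⟨ eval-apps _ M idEnv ⟩
  appsV C (eval (lift Ξ (ϱ A) (injR Ξ x)) idEnv) W
    ≡⟨ appsV-cong C (eval-lift-injR Ξ (ϱ A) x idEnv-≈) W-≈ ⟩
  appsV C (eval (ϱ A x) ρ₀) W
    ≡⟨ appsV-lam* C body ρ₀ W ρ₀-≈ W-≈ ⟩
  eval body ρ₁
    ≡⟨ cong (λ k → k idʳ (eval (lam* A inner) ρ₁)) (extendEnv-wk* (args C) ρ₀ W here) ⟩
  app (var (injR Ξ here)) (reify A (eval (lam* A inner) ρ₁))
    ≡⟨ cong (app (var (injR Ξ here))) (reify-lam* A inner ρ₁) ⟩
  app (var (injR Ξ here)) (lam* A (eval inner ρ₂))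
    ≡⟨ cong (λ t → app (var (injR Ξ here)) (lam* A t)) inner-nf ⟩
  app (var (injR Ξ here)) (lam* A (apps (var (bound (args A) x)) (renameArgs* (args A) (nfArgs M))))
    ∎
  where
  W = evalArgs M idEnv
  W-≈ = evalArgs-cong M idEnv-≈
  ρ₀ : Env ((A ⇒ o) ∷ []) (Ξ ++ ((A ⇒ o) ∷ []))
  ρ₀ y = idEnv (injR Ξ y)
  ρ₀-≈ : ρ₀ ≈ᴱ ρ₀
  ρ₀-≈ y = idEnv-≈ (injR Ξ y)
  ρ₁ = extendEnv (args C) ρ₀ W
  ρ₁-≈ = extendEnv-cong (args C) ρ₀-≈ W-≈
  ρ₂ = liftEnv* (args A) ρ₁
  ys = boundArgs (args A) (args C)
  inner = apps (var (bound (args A) x)) ys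
  body = app (var (wk* (args C) here)) (lam* A inner)
  inner-nf : eval inner ρ₂ ≡ apps (var (bound (args A) x)) (renameArgs* (args A) (nfArgs M))
  inner-nf = begin
    eval inner ρ₂
      ≡⟨ eval-apps (var (bound (args A) x)) ys ρ₂ ⟩
    appsV C (ρ₂ (bound (args A) x)) (evalArgs ys ρ₂)
      ≡⟨ appsV-cong C (liftEnv*-bound (args A) ρ₁ x ρ₁-≈)
                      (evalArgs-cong ys (liftEnv*-cong (args A) ρ₁-≈)) ⟩
    appsV C (reflect C (var (bound (args A) x))) (evalArgs ys ρ₂)
      ≡⟨ appsV-reflect C (var (bound (args A) x)) (evalArgs ys ρ₂) ⟩
    apps (var (bound (args A) x)) (reifyArgs (evalArgs ys ρ₂))
      ≡⟨ cong (apps (var (bound (args A) x))) (reifyArgs-eval-boundArgs (args A) (args C) ρ₀ W W-≈) ⟩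
    apps (var (bound (args A) x)) (renameArgs* (args A) (nfArgs M))
      ∎

ϱ-nf : ∀ Ξ A {C} {a : Ξ ++ args A ∋ C} → View Ξ a →
       Args (Ξ ++ ((A ⇒ o) ∷ [])) (args C) → Tm (Ξ ++ ((A ⇒ o) ∷ [])) o
ϱ-nf Ξ A (isL y) M = apps (var (injL Ξ y)) (nfArgs M)
ϱ-nf Ξ A (isR x) M =
  app (var (injR Ξ here)) (lam* A (apps (var (bound (args A) x)) (renameArgs* (args A) (nfArgs M))))

nf-lift-ϱ : ∀ Ξ A {C} {a : Ξ ++ args A ∋ C} (v : View Ξ a) M →
            nf (apps (lift Ξ (ϱ A) a) M) ≡ ϱ-nf Ξ A v M
nf-lift-ϱ Ξ A (isL y) M = nf-lift-injL Ξ (ϱ A) y M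
nf-lift-ϱ Ξ A (isR x) M = nf-lift-injR Ξ A x M

ϱ-nf-injective : ∀ Ξ A {C D} {a : Ξ ++ args A ∋ C} {b : Ξ ++ args A ∋ D}
                 (v : View Ξ a) (w : View Ξ b) M N → ϱ-nf Ξ A v M ≡ ϱ-nf Ξ A w N → SameHead a b M N
ϱ-nf-injective Ξ A (isL y) (isL y') M N e with apps-var-injective (injL Ξ y) (injL Ξ y') _ _ e
... | sameVar e₁ e₂ with injL-injective Ξ e₁
... | ≡.refl = same (nfArgs-injective M N e₂)
ϱ-nf-injective Ξ A (isL y) (isR x') M N e with apps-var-injective (injL Ξ y) (injR Ξ here) _ (_ ∷ []) e
... | sameVar e₁ _ = ⊥-elim (injL≢injR Ξ e₁)
ϱ-nf-injective Ξ A (isR x) (isL y') M N e with apps-var-injective (injL Ξ y') (injR Ξ here) _ (_ ∷ []) (≡.sym e)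
... | sameVar e₁ _ = ⊥-elim (injL≢injR Ξ e₁)
ϱ-nf-injective Ξ A (isR x) (isR x') M N e with app-injective e
... | sameApp _ e₂ with apps-var-injective (bound (args A) x) (bound (args A) x') _ _ (lam*-injective A e₂)
... | sameVar e₃ e₄ with bound-injective (args A) e₃
... | ≡.refl = same (nfArgs-injective M N (renameArgs*-injective (args A) _ _ e₄))

ϱ-atomic : ∀ A → IsAtomic (ϱ A)
ϱ-atomic A Ξ a b M N h = ϱ-nf-injective Ξ A (view Ξ a) (view Ξ b) M N (begin
  ϱ-nf Ξ A (view Ξ a) M                ≡⟨ ≡.sym (nf-lift-ϱ Ξ A (view Ξ a) M) ⟩
  nf (apps (lift Ξ (ϱ A) a) M)         ≡⟨ nf-cong h ⟩
  nf (apps (lift Ξ (ϱ A) b) N)         ≡⟨ nf-lift-ϱ Ξ A (view Ξ b) N ⟩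
  ϱ-nf Ξ A (view Ξ b) N                ∎)

lemmaL : (A : Ty) → A ≤ᵃ ⟦⟦ A ⟧⟧
lemmaL A = ϱ A , ϱ-atomic A
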